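{- Let $s\ge 2$ be an integer. Every $2K_2$-split graph that is a minimal $(s,\infty)$-polar obstruction has at most $2s+4$ vertices, and this bound is tight. Consequently, there are only finitely many $2K_2$-split minimal $(s,\infty)$-polar obstructions.
   Context: All graphs are finite and simple. A graph $G$ is $2K_2$-split if $V_G$ has a partition $(C,S,I)$ with $C$ a clique, $I$ independent, $S=\varnothing$ or $G[S]\cong 2K_2$, every vertex of $C$ adjacent to every vertex of $S$, and no edges between $I$ and $S$. $G$ is $(s,\infty)$-polar if $V_G$ has a partition $(A,B)$ with $G[A]$ a complete multipartite graph with at most $s$ parts and $G[B]$ a disjoint union of complete graphs. A minimal $(s,\infty)$-polar obstruction is a graph that is not $(s,\infty)$-polar but every vertex-deleted subgraph of which is. -}

module Defs where

open import Data.Nat using (ℕ; zero; suc)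
open import Data.Fin using (Fin; punchIn)
open import Data.Bool using (Bool; true; false)
open import Data.Product using (Σ; ∃; _×_; _,_)
open import Data.Sum using (_⊎_)
open import Data.List using (List)
open import Data.List.Membership.Propositional using (_∈_)
open import Relation.Binary.PropositionalEquality using (_≡_; _≢_)
open import Relation.Nullary using (¬_)
open import Function.Bundles using (_⤖_; Bijection)

record Graph : Set where
  field
    n      : ℕ
    adj    : Fin n → Fin n → Bool
    sym    : ∀ u v → adj u v ≡ adj v u
    irrefl : ∀ v → adj v v ≡ false

open Graph public

Adj : (G : Graph) → Fin (n G) → Fin (n G) → Set
Adj G u v = adj G u v ≡ true

private
  delAux : (m : ℕ) (a : Fin m → Fin m → Bool)
           (sy : ∀ u v → a u v ≡ a v u) (ir : ∀ v → a v v ≡ false)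
           → Fin m → Graph
  delAux (suc m) a sy ir v = record
    { n = m
    ; adj = λ i j → a (punchIn v i) (punchIn v j)
    ; sym = λ i j → sy (punchIn v i) (punchIn v j)
    ; irrefl = λ i → ir (punchIn v i)
    }

_─_ : (G : Graph) → Fin (n G) → Graph
G ─ v = delAux (n G) (adj G) (sym G) (irrefl G) v

-- Partition (A,B) of V_G: inA v ≡ true means v ∈ A, otherwise v ∈ B.
-- G[A] is complete multipartite with at most s parts: there is an
-- assignment of the vertices of A to parts Fin s such that two distinct
-- vertices of A are adjacent iff they lie in different parts.
-- G[B] is a disjoint union of complete graphs: there is an assignment of
-- the vertices of B to components such that two distinct vertices of B
-- are adjacent iff they lie in the same component.
IsSInfPolarPartition : ℕ → (G : Graph) → (Fin (n G) → Bool) → Set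
IsSInfPolarPartition s G inA =
  (Σ (Fin (n G) → Fin s) λ part →
     ∀ u v → inA u ≡ true → inA v ≡ true → u ≢ v →
       (Adj G u v → part u ≢ part v) × (part u ≢ part v → Adj G u v))
  ×
  (Σ (Fin (n G) → Fin (n G)) λ comp →
     ∀ u v → inA u ≡ false → inA v ≡ false → u ≢ v →
       (Adj G u v → comp u ≡ comp v) × (comp u ≡ comp v → Adj G u v))

SInfPolar : ℕ → Graph → Set
SInfPolar s G = Σ (Fin (n G) → Bool) (IsSInfPolarPartition s G)

MinimalSInfPolarObstruction : ℕ → Graph → Set
MinimalSInfPolarObstruction s G =
  ¬ SInfPolar s G × (∀ v → SInfPolar s (G ─ v))

data Part : Set where
  cC sS iI : Part

Is2K2 : (G : Graph) → (Fin (n G) → Part) → Set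
Is2K2 G p =
  Σ (Fin (n G)) λ a → Σ (Fin (n G)) λ b → Σ (Fin (n G)) λ c → Σ (Fin (n G)) λ d →
    (a ≢ b × a ≢ c × a ≢ d × b ≢ c × b ≢ d × c ≢ d)
    × (p a ≡ sS × p b ≡ sS × p c ≡ sS × p d ≡ sS)
    × (∀ v → p v ≡ sS → v ≡ a ⊎ v ≡ b ⊎ v ≡ c ⊎ v ≡ d)
    × (Adj G a b × Adj G c d)
    × (¬ Adj G a c × ¬ Adj G a d × ¬ Adj G b c × ¬ Adj G b d)

Is2K2SplitPartition : (G : Graph) → (Fin (n G) → Part) → Set
Is2K2SplitPartition G p =
  (∀ u v → p u ≡ cC → p v ≡ cC → u ≢ v → Adj G u v)
  × (∀ u v → p u ≡ iI → p v ≡ iI → ¬ Adj G u v)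
  × ((∀ v → p v ≢ sS) ⊎ Is2K2 G p)
  × (∀ u v → p u ≡ cC → p v ≡ sS → Adj G u v)
  × (∀ u v → p u ≡ iI → p v ≡ sS → ¬ Adj G u v)

Is2K2Split : Graph → Set
Is2K2Split G = Σ (Fin (n G) → Part) (Is2K2SplitPartition G)

_≅_ : Graph → Graph → Set
G ≅ H = Σ (Fin (n G) ⤖ Fin (n H)) λ f →
  ∀ u v → adj H (Bijection.to f u) (Bijection.to f v) ≡ adj G u v

{-# OPTIONS --safe #-}
-- Write s = k + 2, let (C, S, I) be the 2K₂-split partition and let N_I(W) be the set
-- of vertices of C ∩ W with a neighbour in I ∩ W.  If S = ∅ the graph is polar (A = I).
-- Otherwise, for W ⊇ S, the subgraph G[W] is polar as soon as |C ∩ W| ≤ s (A = C) or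
-- |N_I(W)| ≤ s − 2 (A = N_I(W) plus an edge of the 2K₂).  Conversely, in a polar
-- partition of G[W] either C ∩ W ⊆ A, so |C ∩ W| ≤ s, or some vertex of C lies in B;
-- then S ∩ B is a clique, so A contains an edge e of S while B meets S, and this forces
-- N_I(W) into A, in parts different from those of the ends of e.
-- In a minimal obstruction both bounds fail for W = V, and one of them holds for
-- W = V − x whenever x ∉ S.  Deleting a vertex of C gives |C| ≤ s + 1.  Deleting y ∈ I
-- leaves C intact, so |N_I(V − y)| ≤ s − 2 < |N_I(V)|: y has a private neighbour in N_I,
-- and the private neighbours of I − y₀ lie in N_I(V − y₀), so |I| ≤ s − 1.  Altogether
-- |V| ≤ (s + 1) + 4 + (s − 1).  Equality holds for K_{s+1} complete to a 2K₂ with s − 1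
-- pendant vertices on distinct clique vertices, and there are finitely many
-- obstructions because every graph is isomorphic to the graph of its adjacency table.
module Submission where

open import Level using (Level; 0ℓ)
open import Data.Bool using (Bool; true; false; if_then_else_; not; _∧_)
import Data.Bool as Bool
open import Data.Bool.Properties using (¬-not; ∧-zeroʳ; ∧-comm; ∧-idem; ∧-identityʳ)
open import Data.Empty using (⊥; ⊥-elim)
open import Data.Fin using (Fin; zero; suc; punchIn; punchOut)
open import Data.Fin.Properties
  using ( _≟_; any?; +↔⊎; suc-injective; 0≢1+n; injective⇒≤
        ; punchIn-injective; punchInᵢ≢i; punchIn-punchOut; punchOut-injective)
open import Data.List using (List; []; _∷_; map; concatMap; cartesianProductWith; upTo)
open import Data.List.Membership.Propositional using (_∈_; lose)
open import Data.List.Membership.Propositional.Properties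
  using (∈-map⁺; ∈-concatMap⁺; ∈-cartesianProductWith⁺; ∈-upTo⁺)
open import Data.List.Relation.Unary.Any using (here; there)
open import Data.Maybe using (Maybe; just; nothing; maybe′; fromMaybe)
import Data.Maybe as Maybe
open import Data.Nat using (ℕ; zero; suc; _≤_; _+_; _*_; z≤n; s≤s)
open import Data.Nat.Properties
  using ( ≤-refl; ≤-reflexive; ≤-trans; ≤-antisym; ≤-pred; m≤n⇒m≤1+n; n≤1+n; n≤0⇒n≡0; 1+n≰n
        ; +-suc; +-mono-≤; +-monoʳ-≤; +-monoˡ-≤; module ≤-Reasoning)
open import Data.Nat.Tactic.RingSolver using (solve-∀)
open import Data.Product using (Σ; ∃; _×_; _,_; proj₁; proj₂)
open import Data.Sum using (_⊎_; inj₁; inj₂)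
import Data.Sum as Sum
open import Data.Sum.Function.Propositional using (_⊎-↔_)
open import Data.Sum.Properties using (inj₁-injective)
open import Data.Unit using (tt)
open import Data.Vec using (Vec; []; _∷_; lookup; tabulate)
open import Data.Vec.Properties using (lookup∘tabulate)
open import Function using (_∘_; id; _↔_; Inverse; mk⇔)
open import Function.Construct.Identity using (⤖-id)
open import Function.Definitions using (Injective)
open import Function.Properties.Inverse using (↔-refl; ↔-trans)
open import Relation.Binary.PropositionalEquality using (_≡_; _≢_; refl; sym; trans; cong; cong₂; subst; subst₂)
open import Relation.Nullary using (¬_; Dec; yes; no; does; contradiction; ¬?; _×-dec_; _⊎-dec_)
open import Relation.Nullary.Decidable using (dec-true; dec-false; does-⇔)
open import Relation.Unary using (Pred; Decidable; _⊆_; _∩_; _∪_; ∁; U; ｛_｝)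
open import Relation.Unary.Properties using (_∩?_; _∪?_; ∁?; U?)

open import Defs hiding (sym)

private
  variable
    ℓ ℓ′ : Level
    k m s : ℕ

does≡true⇒ : {X : Set ℓ} (X? : Dec X) → does X? ≡ true → X
does≡true⇒ (yes x) _ = x

does≡false⇒¬ : {X : Set ℓ} (X? : Dec X) → does X? ≡ false → ¬ X
does≡false⇒¬ (no ¬x) _ = ¬x

does-≟-sym : (i j : Fin m) → does (i ≟ j) ≡ does (j ≟ i)
does-≟-sym i j = does-⇔ (mk⇔ sym sym) (i ≟ j) (j ≟ i)

∄∖⇒⊆ : {A : Set} {P : Pred A ℓ} {Q : Pred A ℓ′} (Q? : Decidable Q) → ¬ ∃ (λ x → P x × ¬ Q x) → P ⊆ Q
∄∖⇒⊆ Q? ∄ {x} px with Q? x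
... | yes qx = qx
... | no ¬qx = contradiction (x , px , ¬qx) ∄

-- Counting decidable subsets of Fin m

count : {P : Pred (Fin m) ℓ} → Decidable P → ℕ
count {m = zero}  P? = 0
count {m = suc m} P? = (if does (P? zero) then suc else id) (count (P? ∘ suc))

count-mono : {P : Pred (Fin m) ℓ} {Q : Pred (Fin m) ℓ′} (P? : Decidable P) (Q? : Decidable Q) →
             P ⊆ Q → count P? ≤ count Q?
count-mono {m = zero}  P? Q? P⊆Q = z≤n
count-mono {m = suc m} P? Q? P⊆Q with P? zero | Q? zero
... | yes _  | yes _  = s≤s (count-mono (P? ∘ suc) (Q? ∘ suc) P⊆Q)
... | yes p  | no ¬q  = contradiction (P⊆Q p) ¬q
... | no _   | yes _  = m≤n⇒m≤1+n (count-mono (P? ∘ suc) (Q? ∘ suc) P⊆Q)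
... | no _   | no _   = count-mono (P? ∘ suc) (Q? ∘ suc) P⊆Q

count-cong : {P : Pred (Fin m) ℓ} {Q : Pred (Fin m) ℓ′} (P? : Decidable P) (Q? : Decidable Q) →
             P ⊆ Q → Q ⊆ P → count P? ≡ count Q?
count-cong P? Q? P⊆Q Q⊆P = ≤-antisym (count-mono P? Q? P⊆Q) (count-mono Q? P? Q⊆P)

count-U : count (U? {A = Fin m}) ≡ m
count-U {m = zero}  = refl
count-U {m = suc m} = cong suc count-U

count-∪ : {P : Pred (Fin m) ℓ} {Q : Pred (Fin m) ℓ′} (P? : Decidable P) (Q? : Decidable Q) →
          count (P? ∪? Q?) ≤ count P? + count Q?
count-∪ {m = zero}  P? Q? = z≤n
count-∪ {m = suc m} P? Q? with P? zero | Q? zero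
... | yes _ | yes _ = s≤s (≤-trans (count-∪ (P? ∘ suc) (Q? ∘ suc)) (+-monoʳ-≤ (count (P? ∘ suc)) (n≤1+n _)))
... | yes _ | no _  = s≤s (count-∪ (P? ∘ suc) (Q? ∘ suc))
... | no _  | yes _ = ≤-trans (s≤s (count-∪ (P? ∘ suc) (Q? ∘ suc))) (≤-reflexive (sym (+-suc (count (P? ∘ suc)) _)))
... | no _  | no _  = count-∪ (P? ∘ suc) (Q? ∘ suc)

private
  count-tail-∁ : {P : Pred (Fin (suc m)) ℓ} (P? : Decidable P) (x : Fin m) →
                 count (λ i → (P? ∩? ∁? (suc x ≟_)) (suc i)) ≡ count ((P? ∘ suc) ∩? ∁? (x ≟_))
  count-tail-∁ P? x = count-cong (λ i → (P? ∩? ∁? (suc x ≟_)) (suc i)) ((P? ∘ suc) ∩? ∁? (x ≟_))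
    (λ (p , x≢i) → p , x≢i ∘ cong suc) (λ (p , x≢i) → p , x≢i ∘ suc-injective)

count-remove : {P : Pred (Fin m) ℓ} (P? : Decidable P) {x : Fin m} → P x →
               suc (count (P? ∩? ∁? (x ≟_))) ≡ count P?
count-remove {m = suc m} P? {zero} p with P? zero
... | yes _ = cong suc (count-cong (λ i → (P? ∩? ∁? (zero ≟_)) (suc i)) (P? ∘ suc) proj₁ (λ q → q , λ ()))
... | no ¬p = contradiction p ¬p
count-remove {m = suc m} P? {suc x} p with P? zero
... | yes _ = cong suc (trans (cong suc (count-tail-∁ P? x)) (count-remove (P? ∘ suc) p))
... | no _  = trans (cong suc (count-tail-∁ P? x)) (count-remove (P? ∘ suc) p)

count-remove≤ : {P : Pred (Fin m) ℓ} (P? : Decidable P) {x : Fin m} → P x →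
                count P? ≤ suc (count (P? ∩? ∁? (x ≟_)))
count-remove≤ P? p = ≤-reflexive (sym (count-remove P? p))

record _↣_ {A : Set} (P : Pred A ℓ) (B : Set) : Set ℓ where
  field
    to        : ∀ {x} → P x → B
    injective : ∀ {x y} (p : P x) (q : P y) → to p ≡ to q → x ≡ y

open _↣_

↣-suc : {P : Pred (Fin (suc m)) ℓ} {B : Set} → P ↣ B → (P ∘ suc) ↣ B
↣-suc e = record { to = to e ; injective = λ p q eq → suc-injective (injective e p q eq) }

↣-punchOut : {A : Set} {P : Pred A ℓ} (e : P ↣ Fin (suc s)) (i : Fin (suc s)) →
             (∀ {x} (p : P x) → i ≢ to e p) → P ↣ Fin s
↣-punchOut e i avoid = record
  { to        = λ p → punchOut (avoid p)
  ; injective = λ p q eq → injective e p q (punchOut-injective (avoid p) (avoid q) eq)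
  }

↣-empty : {P : Pred (Fin 0) ℓ} {B : Set} → P ↣ B
↣-empty = record { to = λ { {()} } ; injective = λ { {()} } }

↣-skip : {P : Pred (Fin (suc m)) ℓ} {B : Set} → ¬ P zero → (P ∘ suc) ↣ B → P ↣ B
↣-skip {P = P} {B} ¬p₀ e = record { to = to′ ; injective = injective′ }
  where
  to′ : ∀ {x} → P x → B
  to′ {zero}  p = contradiction p ¬p₀
  to′ {suc _} p = to e p
  injective′ : ∀ {x y} (p : P x) (q : P y) → to′ p ≡ to′ q → x ≡ y
  injective′ {zero}          p _ _  = contradiction p ¬p₀
  injective′ {suc _} {zero}  _ q _  = contradiction q ¬p₀
  injective′ {suc _} {suc _} p q eq = cong suc (injective e p q eq)

↣-cons : ∀ {s} {P : Pred (Fin (suc m)) ℓ} → (P ∘ suc) ↣ Fin s → P ↣ Fin (suc s)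
↣-cons {s = s} {P = P} e = record { to = to′ ; injective = injective′ }
  where
  to′ : ∀ {x} → P x → Fin (suc s)
  to′ {zero}  _ = zero
  to′ {suc _} p = suc (to e p)
  injective′ : ∀ {x y} (p : P x) (q : P y) → to′ p ≡ to′ q → x ≡ y
  injective′ {zero}  {zero}  _ _ _  = refl
  injective′ {suc _} {suc _} p q eq = cong suc (injective e p q (suc-injective eq))

↣Fin⇒count≤ : {P : Pred (Fin m) ℓ} (P? : Decidable P) → P ↣ Fin s → count P? ≤ s
↣Fin⇒count≤ {m = zero}  P? e = z≤n
↣Fin⇒count≤ {m = suc m} {s = zero} P? e with P? zero
... | yes p₀ = contradiction (to e p₀) λ ()
... | no _   = ↣Fin⇒count≤ (P? ∘ suc) (↣-suc e)
↣Fin⇒count≤ {m = suc m} {s = suc s} P? e with P? zero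
... | yes p₀ = s≤s (↣Fin⇒count≤ (P? ∘ suc)
                     (↣-punchOut (↣-suc e) (to e p₀) λ p eq → 0≢1+n (injective e p₀ p eq)))
... | no _   = ↣Fin⇒count≤ (P? ∘ suc) (↣-suc e)

count≤⇒↣Fin : {P : Pred (Fin m) ℓ} (P? : Decidable P) → count P? ≤ s → P ↣ Fin s
count≤⇒↣Fin {m = zero}  P? _ = ↣-empty
count≤⇒↣Fin {m = suc m} P? le with P? zero
count≤⇒↣Fin {m = suc m} P? (s≤s le) | yes _ = ↣-cons (count≤⇒↣Fin (P? ∘ suc) le)
count≤⇒↣Fin {m = suc m} P? le       | no ¬p₀ = ↣-skip ¬p₀ (count≤⇒↣Fin (P? ∘ suc) le)

↣⇒count≤count : {P : Pred (Fin m) ℓ} {Q : Pred (Fin k) ℓ′} (P? : Decidable P) (Q? : Decidable Q)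
                (e : P ↣ Fin k) → (∀ {x} (p : P x) → Q (to e p)) → count P? ≤ count Q?
↣⇒count≤count P? Q? e e∈Q = ↣Fin⇒count≤ P? record
  { to        = λ p → to r (e∈Q p)
  ; injective = λ p q eq → injective e p q (injective r (e∈Q p) (e∈Q q) eq)
  }
  where r = count≤⇒↣Fin Q? ≤-refl

injective⇒≤count : {Q : Pred (Fin m) ℓ} (Q? : Decidable Q) (f : Fin k → Fin m) →
                   Injective _≡_ _≡_ f → (∀ i → Q (f i)) → k ≤ count Q?
injective⇒≤count Q? f f-inj Q∘f =
  injective⇒≤ (λ eq → f-inj (injective r (Q∘f _) (Q∘f _) eq))
  where r = count≤⇒↣Fin Q? ≤-refl

count-｛｝ : (x : Fin m) → count (x ≟_) ≤ 1
count-｛｝ x = ↣Fin⇒count≤ (x ≟_) record { to = λ _ → zero ; injective = λ p q _ → trans (sym p) q }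

count-｛｝∪ : {Q : Pred (Fin m) ℓ} (x : Fin m) (Q? : Decidable Q) → count ((x ≟_) ∪? Q?) ≤ suc (count Q?)
count-｛｝∪ x Q? = ≤-trans (count-∪ (x ≟_) Q?) (+-monoˡ-≤ (count Q?) (count-｛｝ x))

∄⇒count≡0 : {P : Pred (Fin m) ℓ} (P? : Decidable P) → ¬ ∃ P → count P? ≡ 0
∄⇒count≡0 P? ∄ = n≤0⇒n≡0 (↣Fin⇒count≤ P? record
  { to = λ p → contradiction (_ , p) ∄ ; injective = λ p → contradiction (_ , p) ∄ })

first : {P : Pred (Fin m) ℓ} → Decidable P → Maybe (Fin m)
first {m = zero}  P? = nothing
first {m = suc m} P? = if does (P? zero) then just zero else Maybe.map suc (first (P? ∘ suc))

first-cong : {P : Pred (Fin m) ℓ} {Q : Pred (Fin m) ℓ′} (P? : Decidable P) (Q? : Decidable Q) →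
             P ⊆ Q → Q ⊆ P → first P? ≡ first Q?
first-cong {m = zero}  P? Q? P⊆Q Q⊆P = refl
first-cong {m = suc m} P? Q? P⊆Q Q⊆P with P? zero | Q? zero
... | yes _ | yes _  = refl
... | yes p | no ¬q  = contradiction (P⊆Q p) ¬q
... | no ¬p | yes q  = contradiction (Q⊆P q) ¬p
... | no _  | no _   = cong (Maybe.map suc) (first-cong (P? ∘ suc) (Q? ∘ suc) P⊆Q Q⊆P)

first-just : {P : Pred (Fin m) ℓ} (P? : Decidable P) {x : Fin m} → P x →
             ∃ λ w → first P? ≡ just w × P w
first-just {m = suc m} P? p with P? zero
first-just {m = suc m} P? p         | yes p₀ = zero , refl , p₀
first-just {m = suc m} P? {zero} p  | no ¬p₀ = contradiction p ¬p₀
first-just {m = suc m} P? {suc x} p | no _ with first-just (P? ∘ suc) p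
... | w , eq , pw = suc w , cong (Maybe.map suc) eq , pw

Adj-sym : (G : Graph) {u v : Fin (n G)} → Adj G u v → Adj G v u
Adj-sym G {u} {v} uv = trans (Graph.sym G v u) uv

Adj⇒≢ : (G : Graph) {u v : Fin (n G)} → Adj G u v → u ≢ v
Adj⇒≢ G {u} uu refl = contradiction (trans (sym uu) (irrefl G u)) λ ()

Adj? : (G : Graph) (u v : Fin (n G)) → Dec (Adj G u v)
Adj? G u v = adj G u v Bool.≟ true

P₃-free : (G : Graph) → Pred (Fin (n G)) ℓ → Set ℓ
P₃-free G B = ∀ {u v w} → B u → B v → B w → u ≢ w → Adj G u v → Adj G v w → Adj G u w

-- A P₃-free graph is a disjoint union of cliques: label each vertex by the first vertex
-- of its closed neighbourhood.
module Components (H : Graph) {B : Pred (Fin (n H)) ℓ} (B? : Decidable B) (B-P₃-free : P₃-free H B) where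

  ClosedNbr : Fin (n H) → Pred (Fin (n H)) ℓ
  ClosedNbr u w = B w × (u ≡ w ⊎ Adj H u w)

  ClosedNbr? : ∀ u → Decidable (ClosedNbr u)
  ClosedNbr? u w = B? w ×-dec (u ≟ w ⊎-dec Adj? H u w)

  component : Fin (n H) → Fin (n H)
  component u = fromMaybe u (first (ClosedNbr? u))

  ClosedNbr-⊆ : ∀ {u v} → B u → B v → Adj H u v → ClosedNbr u ⊆ ClosedNbr v
  ClosedNbr-⊆ bu bv uv (bw , inj₁ refl) = bw , inj₂ (Adj-sym H uv)
  ClosedNbr-⊆ {v = v} bu bv uv {w} (bw , inj₂ uw) with v ≟ w
  ... | yes v≡w = bw , inj₁ v≡w
  ... | no v≢w  = bw , inj₂ (B-P₃-free bv bu bw v≢w (Adj-sym H uv) uw)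

  component∈ClosedNbr : ∀ {u} → B u → ClosedNbr u (component u)
  component∈ClosedNbr {u} bu with first-just (ClosedNbr? u) (bu , inj₁ refl)
  ... | w , eq , nw rewrite eq = nw

  Adj⇒same-component : ∀ {u v} → B u → B v → Adj H u v → component u ≡ component v
  Adj⇒same-component {u} {v} bu bv uv with first-just (ClosedNbr? u) (bu , inj₁ refl)
  ... | w , eq , _ = trans (cong (fromMaybe u) eq) (cong (fromMaybe v) (sym (trans same eq)))
    where
    same : first (ClosedNbr? v) ≡ first (ClosedNbr? u)
    same = first-cong (ClosedNbr? v) (ClosedNbr? u) (ClosedNbr-⊆ bv bu (Adj-sym H uv)) (ClosedNbr-⊆ bu bv uv)

  same-component⇒Adj : ∀ {u v} → B u → B v → u ≢ v → component u ≡ component v → Adj H u v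
  same-component⇒Adj {u} {v} bu bv u≢v eq with component∈ClosedNbr bu | component∈ClosedNbr bv
  ... | _  , inj₁ u≡c | _ , inj₁ v≡c = contradiction (trans u≡c (trans eq (sym v≡c))) u≢v
  ... | _  , inj₁ u≡c | _ , inj₂ vc  = Adj-sym H (subst (Adj H v) (sym (trans u≡c eq)) vc)
  ... | _  , inj₂ uc  | _ , inj₁ v≡c = subst (Adj H u) (trans eq (sym v≡c)) uc
  ... | bc , inj₂ uc  | _ , inj₂ vc  = B-P₃-free bu bc bv u≢v uc (Adj-sym H (subst (Adj H v) (sym eq) vc))

-- Polarity of induced subgraphs

-- (A, ∁ A) is an (s,∞)-polar partition of G[W], except that ∁ A is only asked to be
-- P₃-free (see Components).
record PolarOn (s : ℕ) (G : Graph) (W : Pred (Fin (n G)) 0ℓ) : Set₁ where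
  field
    A            : Pred (Fin (n G)) 0ℓ
    A?           : Decidable A
    part         : Fin (n G) → Fin s
    multipartite : ∀ {u v} → W u → W v → A u → A v → u ≢ v →
                   (Adj G u v → part u ≢ part v) × (part u ≢ part v → Adj G u v)
    B-P₃-free    : P₃-free G (W ∩ ∁ A)

record IsInducedOn (H G : Graph) (W : Pred (Fin (n G)) 0ℓ) : Set where
  field
    ι           : Fin (n H) → Fin (n G)
    ι-injective : Injective _≡_ _≡_ ι
    ι-adj       : ∀ i j → adj H i j ≡ adj G (ι i) (ι j)
    ι-∈         : ∀ i → W (ι i)
    ι-onto      : ∀ {u} → W u → ∃ λ i → ι i ≡ u

U-induced : (G : Graph) → IsInducedOn G G U
U-induced G = record
  { ι = id ; ι-injective = id ; ι-adj = λ _ _ → refl ; ι-∈ = λ _ → tt ; ι-onto = λ {u} _ → u , refl }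

─-induced : (G : Graph) (x : Fin (n G)) → IsInducedOn (G ─ x) G (∁ ｛ x ｝)
─-induced record { n = zero } ()
─-induced record { n = suc m } x = record
  { ι           = punchIn x
  ; ι-injective = punchIn-injective x _ _
  ; ι-adj       = λ _ _ → refl
  ; ι-∈         = λ i → punchInᵢ≢i x i ∘ sym
  ; ι-onto      = λ x≢u → punchOut x≢u , punchIn-punchOut x≢u
  }

module _ {H G : Graph} {W : Pred (Fin (n G)) 0ℓ} (H≤G : IsInducedOn H G W) where
  open IsInducedOn H≤G

  private
    Adj-ι : ∀ {i j} → Adj H i j → Adj G (ι i) (ι j)
    Adj-ι {i} {j} ij = trans (sym (ι-adj i j)) ij

    Adj-ι⁻ : ∀ {i j} → Adj G (ι i) (ι j) → Adj H i j
    Adj-ι⁻ {i} {j} ij = trans (ι-adj i j) ij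

    pullback : {X : Set} → (Fin (n H) → X) → X → Fin (n G) → X
    pullback f default u = maybe′ f default (first (λ i → ι i ≟ u))

    pullback-ι : {X : Set} (f : Fin (n H) → X) (default : X) (i : Fin (n H)) → pullback f default (ι i) ≡ f i
    pullback-ι f default i with first-just (λ j → ι j ≟ ι i) {i} refl
    ... | j , eq , ιj≡ιi rewrite eq = cong f (ι-injective ιj≡ιi)

  polarOn⇒polar : PolarOn s G W → SInfPolar s H
  polarOn⇒polar P = does ∘ A? ∘ ι , (part ∘ ι , multipartite′) , (component , component-spec)
    where
    open PolarOn P
    inB? : Decidable (λ i → ¬ A (ι i))
    inB? i = ¬? (A? (ι i))
    inB-P₃-free : P₃-free H (λ i → ¬ A (ι i))
    inB-P₃-free bi bj bk i≢k ij jk =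
      Adj-ι⁻ (B-P₃-free (ι-∈ _ , bi) (ι-∈ _ , bj) (ι-∈ _ , bk) (i≢k ∘ ι-injective) (Adj-ι ij) (Adj-ι jk))
    open Components H inB? inB-P₃-free
    multipartite′ : ∀ i j → does (A? (ι i)) ≡ true → does (A? (ι j)) ≡ true → i ≢ j →
                    (Adj H i j → part (ι i) ≢ part (ι j)) × (part (ι i) ≢ part (ι j) → Adj H i j)
    multipartite′ i j ai aj i≢j
      with multipartite (ι-∈ i) (ι-∈ j) (does≡true⇒ (A? (ι i)) ai) (does≡true⇒ (A? (ι j)) aj)
                        (i≢j ∘ ι-injective)
    ... | adj⇒≢ , ≢⇒adj = adj⇒≢ ∘ Adj-ι , Adj-ι⁻ ∘ ≢⇒adj
    component-spec : ∀ i j → does (A? (ι i)) ≡ false → does (A? (ι j)) ≡ false → i ≢ j →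
                     (Adj H i j → component i ≡ component j) × (component i ≡ component j → Adj H i j)
    component-spec i j bi bj i≢j =
      Adj⇒same-component bi′ bj′ , same-component⇒Adj bi′ bj′ i≢j
      where
      bi′ = does≡false⇒¬ (A? (ι i)) bi
      bj′ = does≡false⇒¬ (A? (ι j)) bj

  polar⇒polarOn : SInfPolar (suc s) H → PolarOn (suc s) G W
  polar⇒polarOn (inA , (part , part-spec) , (comp , comp-spec)) = record
    { A            = λ u → pullback inA false u ≡ true
    ; A?           = λ u → pullback inA false u Bool.≟ true
    ; part         = pullback part zero
    ; multipartite = multipartite
    ; B-P₃-free    = B-P₃-free
    }
    where
    inA-ι : ∀ {i} → pullback inA false (ι i) ≡ true → inA i ≡ true
    inA-ι {i} a = trans (sym (pullback-ι inA false i)) a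
    inB-ι : ∀ {i} → ¬ pullback inA false (ι i) ≡ true → inA i ≡ false
    inB-ι {i} b = ¬-not (b ∘ trans (pullback-ι inA false i))
    multipartite : ∀ {u v} → W u → W v → pullback inA false u ≡ true → pullback inA false v ≡ true → u ≢ v →
                   (Adj G u v → pullback part zero u ≢ pullback part zero v) ×
                   (pullback part zero u ≢ pullback part zero v → Adj G u v)
    multipartite wu wv au av u≢v with ι-onto wu | ι-onto wv
    ... | i , refl | j , refl
      rewrite pullback-ι part zero i | pullback-ι part zero j
      with part-spec i j (inA-ι au) (inA-ι av) (u≢v ∘ cong ι)
    ... | adj⇒≢ , ≢⇒adj = adj⇒≢ ∘ Adj-ι⁻ , Adj-ι ∘ ≢⇒adj
    B-P₃-free : P₃-free G (W ∩ ∁ (λ u → pullback inA false u ≡ true))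
    B-P₃-free (wu , bu) (wv , bv) (ww , bw) u≢w uv vw with ι-onto wu | ι-onto wv | ι-onto ww
    ... | i , refl | j , refl | k , refl = Adj-ι (proj₂ (comp-spec i k (inB-ι bu) (inB-ι bw) (u≢w ∘ cong ι))
      (trans (proj₁ (comp-spec i j (inB-ι bu) (inB-ι bv) (Adj⇒≢ H ij)) ij)
             (proj₁ (comp-spec j k (inB-ι bv) (inB-ι bw) (Adj⇒≢ H jk)) jk)))
      where
      ij = Adj-ι⁻ uv
      jk = Adj-ι⁻ vw

clique-polarOn : (G : Graph) {W A : Pred (Fin (n G)) 0ℓ} (W? : Decidable W) (A? : Decidable A) →
  (∀ {u v} → W u → W v → A u → A v → u ≢ v → Adj G u v) →
  count (A? ∩? W?) ≤ suc s →
  P₃-free G (W ∩ ∁ A) → PolarOn (suc s) G W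
clique-polarOn {s = s} G {W} {A} W? A? clique small B-P₃-free = record
  { A            = A
  ; A?           = A?
  ; part         = part
  ; multipartite = λ wu wv au av u≢v →
      (λ _ → u≢v ∘ part-injective (au , wu) (av , wv)) , (λ _ → clique wu wv au av u≢v)
  ; B-P₃-free    = B-P₃-free
  }
  where
  e = count≤⇒↣Fin (A? ∩? W?) small
  part : Fin (n G) → Fin (suc s)
  part u with (A? ∩? W?) u
  ... | yes p = to e p
  ... | no _  = zero
  part-injective : ∀ {u v} → (A ∩ W) u → (A ∩ W) v → part u ≡ part v → u ≡ v
  part-injective {u} {v} p q eq with (A? ∩? W?) u | (A? ∩? W?) v
  ... | yes p′ | yes q′ = injective e p′ q′ eq
  ... | no ¬p  | _      = contradiction p ¬p
  ... | _      | no ¬q  = contradiction q ¬q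

-- 2K₂-split graphs

order-split : ∀ k → suc (suc (suc k)) + (4 + suc k) ≡ 2 * suc (suc k) + 4
order-split = solve-∀

_≟ᴾ_ : (p q : Part) → Dec (p ≡ q)
cC ≟ᴾ cC = yes refl
sS ≟ᴾ sS = yes refl
iI ≟ᴾ iI = yes refl
cC ≟ᴾ sS = no λ ()
cC ≟ᴾ iI = no λ ()
sS ≟ᴾ cC = no λ ()
sS ≟ᴾ iI = no λ ()
iI ≟ᴾ cC = no λ ()
iI ≟ᴾ sS = no λ ()

record SplitPartition (G : Graph) : Set where
  field
    block            : Fin (n G) → Part
    C-clique         : ∀ {u v} → block u ≡ cC → block v ≡ cC → u ≢ v → Adj G u v
    I-independent    : ∀ {u v} → block u ≡ iI → block v ≡ iI → ¬ Adj G u v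
    C-S-complete     : ∀ {u v} → block u ≡ cC → block v ≡ sS → Adj G u v
    I-S-anticomplete : ∀ {u v} → block u ≡ iI → block v ≡ sS → ¬ Adj G u v

module SplitGraph {G : Graph} (sp : SplitPartition G) where
  open SplitPartition sp

  C S I : Pred (Fin (n G)) 0ℓ
  C v = block v ≡ cC
  S v = block v ≡ sS
  I v = block v ≡ iI

  C? : Decidable C
  C? v = block v ≟ᴾ cC
  S? : Decidable S
  S? v = block v ≟ᴾ sS
  I? : Decidable I
  I? v = block v ≟ᴾ iI

  trichotomy : ∀ v → C v ⊎ S v ⊎ I v
  trichotomy v with block v
  ... | cC = inj₁ refl
  ... | sS = inj₂ (inj₁ refl)
  ... | iI = inj₂ (inj₂ refl)

  C⇒¬S : ∀ {v} → C v → ¬ S v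
  C⇒¬S cv sv = contradiction (trans (sym cv) sv) λ ()

  C⇒¬I : ∀ {v} → C v → ¬ I v
  C⇒¬I cv iv = contradiction (trans (sym cv) iv) λ ()

  I⇒¬S : ∀ {v} → I v → ¬ S v
  I⇒¬S iv sv = contradiction (trans (sym iv) sv) λ ()

  I≢S : ∀ {u v} → I u → S v → u ≢ v
  I≢S iu sv refl = I⇒¬S iu sv

  I-nbr⇒C : ∀ {y z} → I y → Adj G y z → C z
  I-nbr⇒C {y} {z} iy yz with trichotomy z
  ... | inj₁ cz         = cz
  ... | inj₂ (inj₁ sz)  = contradiction yz (I-S-anticomplete iy sz)
  ... | inj₂ (inj₂ iz)  = contradiction yz (I-independent iy iz)

  NI : Pred (Fin (n G)) 0ℓ → Pred (Fin (n G)) 0ℓ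
  NI W z = C z × W z × ∃ λ y → I y × W y × Adj G y z

  NI? : {W : Pred (Fin (n G)) 0ℓ} → Decidable W → Decidable (NI W)
  NI? W? z = C? z ×-dec W? z ×-dec any? (λ y → I? y ×-dec W? y ×-dec Adj? G y z)

  NI⊆NI-U : ∀ {W} → NI W ⊆ NI U
  NI⊆NI-U (cz , _ , y , iy , _ , yz) = cz , tt , y , iy , tt , yz

  outside-I⇒C : (∀ v → ¬ S v) → ∀ {v} → ¬ I v → C v
  outside-I⇒C noS {v} ¬iv with trichotomy v
  ... | inj₁ cv         = cv
  ... | inj₂ (inj₁ sv)  = contradiction sv (noS v)
  ... | inj₂ (inj₂ iv)  = contradiction iv ¬iv

  polarOn-noS : {W : Pred (Fin (n G)) 0ℓ} → (∀ v → ¬ S v) → PolarOn (suc s) G W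
  polarOn-noS noS = record
    { A            = I
    ; A?           = I?
    ; part         = λ _ → zero
    ; multipartite = λ _ _ iu iv _ → (λ uv → contradiction uv (I-independent iu iv)) , (λ 0≢0 → contradiction refl 0≢0)
    ; B-P₃-free    = λ (_ , ¬iu) _ (_ , ¬iw) u≢w _ _ → C-clique (outside-I⇒C noS ¬iu) (outside-I⇒C noS ¬iw) u≢w
    }

  outside-C-adj⇒S : ∀ {u v} → ¬ C u → ¬ C v → Adj G u v → S u × S v
  outside-C-adj⇒S {u} {v} ¬cu ¬cv uv with trichotomy u | trichotomy v
  ... | inj₁ cu        | _              = contradiction cu ¬cu
  ... | _              | inj₁ cv        = contradiction cv ¬cv
  ... | inj₂ (inj₂ iu) | _              = contradiction (I-nbr⇒C iu uv) ¬cv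
  ... | _              | inj₂ (inj₂ iv) = contradiction (I-nbr⇒C iv (Adj-sym G uv)) ¬cu
  ... | inj₂ (inj₁ su) | inj₂ (inj₁ sv) = su , sv

  P₃-free-outside-NI : {W A : Pred (Fin (n G)) 0ℓ} → NI W ⊆ A →
    (∀ {u v} → S u → S v → W u → W v → ¬ A u → ¬ A v → u ≢ v → Adj G u v) → P₃-free G (W ∩ ∁ A)
  P₃-free-outside-NI {W} {A} NI⊆A S-clique {u} {v} {w} (wu , ¬au) (wv , ¬av) (ww , ¬aw) u≢w uv vw
    with trichotomy u | trichotomy v | trichotomy w
  ... | _              | _              | inj₂ (inj₂ iw) =
    contradiction (NI⊆A (I-nbr⇒C iw wv′ , wv , w , iw , ww , wv′)) ¬av
    where wv′ = Adj-sym G vw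
  ... | _              | inj₂ (inj₂ iv) | _              =
    contradiction (NI⊆A (I-nbr⇒C iv vu , wu , v , iv , wv , vu)) ¬au
    where vu = Adj-sym G uv
  ... | inj₂ (inj₂ iu) | _              | _              =
    contradiction (NI⊆A (I-nbr⇒C iu uv , wv , u , iu , wu , uv)) ¬av
  ... | inj₁ cu        | _              | inj₁ cw        = C-clique cu cw u≢w
  ... | inj₁ cu        | _              | inj₂ (inj₁ sw) = C-S-complete cu sw
  ... | inj₂ (inj₁ su) | _              | inj₁ cw        = Adj-sym G (C-S-complete cw su)
  ... | inj₂ (inj₁ su) | _              | inj₂ (inj₁ sw) = S-clique su sw wu ww ¬au ¬aw u≢w

  polarOn-via-NI : {W T : Pred (Fin (n G)) 0ℓ} (W? : Decidable W) (T? : Decidable T) → T ⊆ S →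
    (∀ {u v} → T u → T v → u ≢ v → Adj G u v) →
    (∀ {u v} → S u → S v → W u → W v → ¬ T u → ¬ T v → u ≢ v → Adj G u v) →
    count T? + count (NI? W?) ≤ suc s → PolarOn (suc s) G W
  polarOn-via-NI {W = W} {T} W? T? T⊆S T-clique S∖T-clique small =
    clique-polarOn G W? A? A-clique A-small (P₃-free-outside-NI inj₂ λ su sv wu wv ¬au ¬av →
      S∖T-clique su sv wu wv (¬au ∘ inj₁) (¬av ∘ inj₁))
    where
    A? = T? ∪? NI? W?
    A-clique : ∀ {u v} → W u → W v → (T ∪ NI W) u → (T ∪ NI W) v → u ≢ v → Adj G u v
    A-clique _ _ (inj₁ tu)             (inj₁ tv)             u≢v = T-clique tu tv u≢v
    A-clique _ _ (inj₁ tu)             (inj₂ (cv , _))       _   = Adj-sym G (C-S-complete cv (T⊆S tu))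
    A-clique _ _ (inj₂ (cu , _))       (inj₁ tv)             _   = C-S-complete cu (T⊆S tv)
    A-clique _ _ (inj₂ (cu , _))       (inj₂ (cv , _))       u≢v = C-clique cu cv u≢v
    A-small : count (A? ∩? W?) ≤ suc _
    A-small = ≤-trans (count-mono (A? ∩? W?) A? proj₁) (≤-trans (count-∪ T? (NI? W?)) small)

  polarOn-fewNI-S⊆ : {W : Pred (Fin (n G)) 0ℓ} (W? : Decidable W) {e x y : Fin (n G)} → S e → Adj G x y →
    (∀ {v} → S v → W v → v ≡ e ⊎ v ≡ x ⊎ v ≡ y) → count (NI? W?) ≤ s → PolarOn (suc s) G W
  polarOn-fewNI-S⊆ {W = W} W? {e} {x} {y} se xy S∩W⊆exy small =
    polarOn-via-NI W? (e ≟_) (λ { refl → se }) (λ { refl refl e≢e → contradiction refl e≢e }) S∖e-clique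
      (+-mono-≤ (count-｛｝ e) small)
    where
    S∖e-clique : ∀ {u v} → S u → S v → W u → W v → ¬ e ≡ u → ¬ e ≡ v → u ≢ v → Adj G u v
    S∖e-clique su sv wu wv ¬eu ¬ev u≢v with S∩W⊆exy su wu | S∩W⊆exy sv wv
    ... | inj₁ refl        | _                = contradiction refl ¬eu
    ... | _                | inj₁ refl        = contradiction refl ¬ev
    ... | inj₂ (inj₁ refl) | inj₂ (inj₁ refl) = contradiction refl u≢v
    ... | inj₂ (inj₁ refl) | inj₂ (inj₂ refl) = xy
    ... | inj₂ (inj₂ refl) | inj₂ (inj₁ refl) = Adj-sym G xy
    ... | inj₂ (inj₂ refl) | inj₂ (inj₂ refl) = contradiction refl u≢v

  record TwoK₂ : Set where
    field
      a b c d          : Fin (n G)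
      a∈S              : S a
      b∈S              : S b
      c∈S              : S c
      d∈S              : S d
      S-cover          : ∀ {v} → S v → v ≡ a ⊎ v ≡ b ⊎ v ≡ c ⊎ v ≡ d
      a≢c              : a ≢ c
      a≢d              : a ≢ d
      b≢c              : b ≢ c
      b≢d              : b ≢ d
      ab               : Adj G a b
      cd               : Adj G c d
      ¬ac              : ¬ Adj G a c
      ¬ad              : ¬ Adj G a d
      ¬bc              : ¬ Adj G b c
      ¬bd              : ¬ Adj G b d

  module WithTwoK₂ (M : TwoK₂) where
    open TwoK₂ M

    private
      partnerOf : ∀ {v} → v ≡ a ⊎ v ≡ b ⊎ v ≡ c ⊎ v ≡ d → Fin (n G)
      partnerOf (inj₁ _)                = b
      partnerOf (inj₂ (inj₁ _))         = a
      partnerOf (inj₂ (inj₂ (inj₁ _)))  = d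
      partnerOf (inj₂ (inj₂ (inj₂ _)))  = c

      S-nbr≡partner : ∀ {u v} → S u → (sv : S v) → Adj G u v → u ≡ partnerOf (S-cover sv)
      S-nbr≡partner su sv uv with S-cover sv | S-cover su
      ... | inj₁ refl               | inj₁ refl               = contradiction refl (Adj⇒≢ G uv)
      ... | inj₁ refl               | inj₂ (inj₁ refl)        = refl
      ... | inj₁ refl               | inj₂ (inj₂ (inj₁ refl)) = contradiction (Adj-sym G uv) ¬ac
      ... | inj₁ refl               | inj₂ (inj₂ (inj₂ refl)) = contradiction (Adj-sym G uv) ¬ad
      ... | inj₂ (inj₁ refl)        | inj₁ refl               = refl
      ... | inj₂ (inj₁ refl)        | inj₂ (inj₁ refl)        = contradiction refl (Adj⇒≢ G uv)
      ... | inj₂ (inj₁ refl)        | inj₂ (inj₂ (inj₁ refl)) = contradiction (Adj-sym G uv) ¬bc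
      ... | inj₂ (inj₁ refl)        | inj₂ (inj₂ (inj₂ refl)) = contradiction (Adj-sym G uv) ¬bd
      ... | inj₂ (inj₂ (inj₁ refl)) | inj₁ refl               = contradiction uv ¬ac
      ... | inj₂ (inj₂ (inj₁ refl)) | inj₂ (inj₁ refl)        = contradiction uv ¬bc
      ... | inj₂ (inj₂ (inj₁ refl)) | inj₂ (inj₂ (inj₁ refl)) = contradiction refl (Adj⇒≢ G uv)
      ... | inj₂ (inj₂ (inj₁ refl)) | inj₂ (inj₂ (inj₂ refl)) = refl
      ... | inj₂ (inj₂ (inj₂ refl)) | inj₁ refl               = contradiction uv ¬ad
      ... | inj₂ (inj₂ (inj₂ refl)) | inj₂ (inj₁ refl)        = contradiction uv ¬bd
      ... | inj₂ (inj₂ (inj₂ refl)) | inj₂ (inj₂ (inj₁ refl)) = refl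
      ... | inj₂ (inj₂ (inj₂ refl)) | inj₂ (inj₂ (inj₂ refl)) = contradiction refl (Adj⇒≢ G uv)

    S-nbr-unique : ∀ {u v w} → S u → S v → S w → Adj G u v → Adj G w v → u ≡ w
    S-nbr-unique su sv sw uv wv = trans (S-nbr≡partner su sv uv) (sym (S-nbr≡partner sw sv wv))

    polarOn-fewC : {W : Pred (Fin (n G)) 0ℓ} (W? : Decidable W) → count (C? ∩? W?) ≤ suc s → PolarOn (suc s) G W
    polarOn-fewC {W = W} W? small = clique-polarOn G W? C? (λ _ _ → C-clique) small B-P₃-free
      where
      B-P₃-free : P₃-free G (W ∩ ∁ C)
      B-P₃-free (_ , ¬cu) (_ , ¬cv) (_ , ¬cw) u≢w uv vw with outside-C-adj⇒S ¬cu ¬cv uv | outside-C-adj⇒S ¬cv ¬cw vw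
      ... | su , sv | _ , sw = contradiction (S-nbr-unique su sv sw uv (Adj-sym G vw)) u≢w

    polarOn-fewNI : {W : Pred (Fin (n G)) 0ℓ} (W? : Decidable W) → count (NI? W?) ≤ s → PolarOn (suc (suc s)) G W
    polarOn-fewNI {W = W} W? small =
      polarOn-via-NI W? T? T⊆S T-clique S∖T-clique (+-mono-≤ T-small small)
      where
      T? = (c ≟_) ∪? (d ≟_)
      T⊆S : ｛ c ｝ ∪ ｛ d ｝ ⊆ S
      T⊆S (inj₁ refl) = c∈S
      T⊆S (inj₂ refl) = d∈S
      T-clique : ∀ {u v} → (｛ c ｝ ∪ ｛ d ｝) u → (｛ c ｝ ∪ ｛ d ｝) v → u ≢ v → Adj G u v
      T-clique (inj₁ refl) (inj₁ refl) u≢v = contradiction refl u≢v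
      T-clique (inj₁ refl) (inj₂ refl) _   = cd
      T-clique (inj₂ refl) (inj₁ refl) _   = Adj-sym G cd
      T-clique (inj₂ refl) (inj₂ refl) u≢v = contradiction refl u≢v
      S∖T-clique : ∀ {u v} → S u → S v → W u → W v →
                   ¬ (｛ c ｝ ∪ ｛ d ｝) u → ¬ (｛ c ｝ ∪ ｛ d ｝) v → u ≢ v → Adj G u v
      S∖T-clique su sv _ _ ¬tu ¬tv u≢v with S-cover su | S-cover sv
      ... | inj₂ (inj₂ (inj₁ refl)) | _                       = contradiction (inj₁ refl) ¬tu
      ... | inj₂ (inj₂ (inj₂ refl)) | _                       = contradiction (inj₂ refl) ¬tu
      ... | _                       | inj₂ (inj₂ (inj₁ refl)) = contradiction (inj₁ refl) ¬tv
      ... | _                       | inj₂ (inj₂ (inj₂ refl)) = contradiction (inj₂ refl) ¬tv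
      ... | inj₁ refl               | inj₁ refl               = contradiction refl u≢v
      ... | inj₁ refl               | inj₂ (inj₁ refl)        = ab
      ... | inj₂ (inj₁ refl)        | inj₁ refl               = Adj-sym G ab
      ... | inj₂ (inj₁ refl)        | inj₂ (inj₁ refl)        = contradiction refl u≢v
      T-small : count T? ≤ 2
      T-small = ≤-trans (count-｛｝∪ c (d ≟_)) (s≤s (count-｛｝ d))

    polarOn-─S : ∀ {x} → S x → count (NI? (∁? (x ≟_))) ≤ s → PolarOn (suc s) G (∁ ｛ x ｝)
    polarOn-─S {x = x} sx small with S-cover sx
    ... | inj₁ refl =
      polarOn-fewNI-S⊆ (∁? (x ≟_)) b∈S cd (λ sv x≢v → without-a x≢v (S-cover sv)) small
      where
      without-a : ∀ {v} → a ≢ v → v ≡ a ⊎ v ≡ b ⊎ v ≡ c ⊎ v ≡ d → v ≡ b ⊎ v ≡ c ⊎ v ≡ d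
      without-a a≢v (inj₁ refl) = contradiction refl a≢v
      without-a _   (inj₂ v∈bcd) = v∈bcd
    ... | inj₂ (inj₁ refl) =
      polarOn-fewNI-S⊆ (∁? (x ≟_)) a∈S cd (λ sv x≢v → without-b x≢v (S-cover sv)) small
      where
      without-b : ∀ {v} → b ≢ v → v ≡ a ⊎ v ≡ b ⊎ v ≡ c ⊎ v ≡ d → v ≡ a ⊎ v ≡ c ⊎ v ≡ d
      without-b _   (inj₁ v≡a)        = inj₁ v≡a
      without-b b≢v (inj₂ (inj₁ refl)) = contradiction refl b≢v
      without-b _   (inj₂ (inj₂ v∈cd)) = inj₂ v∈cd
    ... | inj₂ (inj₂ (inj₁ refl)) =
      polarOn-fewNI-S⊆ (∁? (x ≟_)) d∈S ab (λ sv x≢v → without-c x≢v (S-cover sv)) small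
      where
      without-c : ∀ {v} → c ≢ v → v ≡ a ⊎ v ≡ b ⊎ v ≡ c ⊎ v ≡ d → v ≡ d ⊎ v ≡ a ⊎ v ≡ b
      without-c _   (inj₁ v≡a)                = inj₂ (inj₁ v≡a)
      without-c _   (inj₂ (inj₁ v≡b))         = inj₂ (inj₂ v≡b)
      without-c c≢v (inj₂ (inj₂ (inj₁ refl))) = contradiction refl c≢v
      without-c _   (inj₂ (inj₂ (inj₂ v≡d)))  = inj₁ v≡d
    ... | inj₂ (inj₂ (inj₂ refl)) =
      polarOn-fewNI-S⊆ (∁? (x ≟_)) c∈S ab (λ sv x≢v → without-d x≢v (S-cover sv)) small
      where
      without-d : ∀ {v} → d ≢ v → v ≡ a ⊎ v ≡ b ⊎ v ≡ c ⊎ v ≡ d → v ≡ c ⊎ v ≡ a ⊎ v ≡ b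
      without-d _   (inj₁ v≡a)                = inj₂ (inj₁ v≡a)
      without-d _   (inj₂ (inj₁ v≡b))         = inj₂ (inj₂ v≡b)
      without-d _   (inj₂ (inj₂ (inj₁ v≡c)))  = inj₁ v≡c
      without-d d≢v (inj₂ (inj₂ (inj₂ refl))) = contradiction refl d≢v

    ab⇒S : ∀ {u} → u ≡ a ⊎ u ≡ b → S u
    ab⇒S (inj₁ refl) = a∈S
    ab⇒S (inj₂ refl) = b∈S

    cd⇒S : ∀ {u} → u ≡ c ⊎ u ≡ d → S u
    cd⇒S (inj₁ refl) = c∈S
    cd⇒S (inj₂ refl) = d∈S

    ab-cd-apart : ∀ {u v} → u ≡ a ⊎ u ≡ b → v ≡ c ⊎ v ≡ d → ¬ Adj G u v × u ≢ v
    ab-cd-apart (inj₁ refl) (inj₁ refl) = ¬ac , a≢c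
    ab-cd-apart (inj₁ refl) (inj₂ refl) = ¬ad , a≢d
    ab-cd-apart (inj₂ refl) (inj₁ refl) = ¬bc , b≢c
    ab-cd-apart (inj₂ refl) (inj₂ refl) = ¬bd , b≢d

    module Necessary {W : Pred (Fin (n G)) 0ℓ} (W? : Decidable W) (S⊆W : S ⊆ W)
                     (P : PolarOn (suc (suc k)) G W) where
      open PolarOn P

      same-part : ∀ {u v} → W u → W v → A u → A v → u ≢ v → ¬ Adj G u v → part u ≡ part v
      same-part {u} {v} wu wv au av u≢v ¬uv with part u ≟ part v
      ... | yes eq = eq
      ... | no ne  = contradiction (proj₂ (multipartite wu wv au av u≢v) ne) ¬uv

      distinct-parts : ∀ {u v} → W u → W v → A u → A v → Adj G u v → part u ≢ part v
      distinct-parts wu wv au av uv = proj₁ (multipartite wu wv au av (Adj⇒≢ G uv)) uv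

      ¬A-edge-nonnbr : ∀ {u v w} → W u → W v → W w → A u → A v → A w → Adj G u v →
                       ¬ Adj G u w → ¬ Adj G v w → u ≢ w → v ≢ w → ⊥
      ¬A-edge-nonnbr wu wv ww au av aw uv ¬uw ¬vw u≢w v≢w =
        distinct-parts wu wv au av uv (trans (same-part wu ww au aw u≢w ¬uw) (sym (same-part wv ww av aw v≢w ¬vw)))

      S∖A-clique : ∀ {x u v} → C x → W x → ¬ A x → S u → S v → ¬ A u → ¬ A v → u ≢ v → Adj G u v
      S∖A-clique cx wx ¬ax su sv ¬au ¬av u≢v =
        B-P₃-free (S⊆W su , ¬au) (wx , ¬ax) (S⊆W sv , ¬av) u≢v (Adj-sym G (C-S-complete cx su)) (C-S-complete cx sv)

      clique↣parts : {Q : Pred (Fin (n G)) ℓ} → Q ⊆ W → Q ⊆ A → (∀ {u v} → Q u → Q v → u ≢ v → Adj G u v) →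
                     Q ↣ Fin (suc (suc k))
      clique↣parts Q⊆W Q⊆A Q-clique = record { to = λ {u} _ → part u ; injective = injective′ }
        where
        injective′ : ∀ {u v} → _ → _ → part u ≡ part v → u ≡ v
        injective′ {u} {v} qu qv eq with u ≟ v
        ... | yes u≡v = u≡v
        ... | no u≢v  = contradiction eq (distinct-parts (Q⊆W qu) (Q⊆W qv) (Q⊆A qu) (Q⊆A qv) (Q-clique qu qv u≢v))

      module _ {e₁ e₂ w : Fin (n G)} (s₁ : S e₁) (s₂ : S e₂) (sw : S w) (a₁ : A e₁) (a₂ : A e₂) (¬aw : ¬ A w)
               (e₁e₂ : Adj G e₁ e₂) where

        NI⊆A : NI W ⊆ A
        NI⊆A {z} (cz , wz , y , iy , wy , yz) with A? z
        ... | yes az = az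
        ... | no ¬az with A? y
        ...   | yes ay = ⊥-elim (distinct-parts (S⊆W s₁) (S⊆W s₂) a₁ a₂ e₁e₂
                  (trans (sym (same-part wy (S⊆W s₁) ay a₁ (I≢S iy s₁) (I-S-anticomplete iy s₁)))
                         (same-part wy (S⊆W s₂) ay a₂ (I≢S iy s₂) (I-S-anticomplete iy s₂))))
        ...   | no ¬ay = ⊥-elim (I-S-anticomplete iy sw
                  (B-P₃-free (wy , ¬ay) (wz , ¬az) (S⊆W sw , ¬aw) (I≢S iy sw) yz (C-S-complete cz sw)))

        fewNI : count (NI? W?) ≤ k
        fewNI = ↣Fin⇒count≤ (NI? W?) (↣-punchOut (↣-punchOut by-part (part e₁) avoid₁) (punchOut e₁≠e₂) avoid₂)
          where
          by-part = clique↣parts (proj₁ ∘ proj₂) NI⊆A λ p q → C-clique (proj₁ p) (proj₁ q)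
          e₁≠e₂ = distinct-parts (S⊆W s₁) (S⊆W s₂) a₁ a₂ e₁e₂
          avoid₁ : ∀ {z} (p : NI W z) → part e₁ ≢ part z
          avoid₁ p@(cz , wz , _) = distinct-parts (S⊆W s₁) wz a₁ (NI⊆A p) (Adj-sym G (C-S-complete cz s₁))
          avoid₂ : ∀ {z} (p : NI W z) → punchOut e₁≠e₂ ≢ punchOut (avoid₁ p)
          avoid₂ p@(cz , wz , _) eq = distinct-parts (S⊆W s₂) wz a₂ (NI⊆A p) (Adj-sym G (C-S-complete cz s₂))
            (punchOut-injective e₁≠e₂ (avoid₁ p) eq)

      both-in-A⊎one-outside : ∀ u v → (A u × A v) ⊎ ∃ λ w → (w ≡ u ⊎ w ≡ v) × ¬ A w
      both-in-A⊎one-outside u v with A? u | A? v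
      ... | yes au | yes av = inj₁ (au , av)
      ... | no ¬au | _      = inj₂ (u , inj₁ refl , ¬au)
      ... | _      | no ¬av = inj₂ (v , inj₂ refl , ¬av)

      fewC⊎fewNI : count (C? ∩? W?) ≤ suc (suc k) ⊎ count (NI? W?) ≤ k
      fewC⊎fewNI with any? (λ x → (C? ∩? W?) x ×-dec ¬? (A? x))
      ... | no ∄x =
        inj₁ (↣Fin⇒count≤ (C? ∩? W?) (clique↣parts proj₂ C∩W⊆A λ p q → C-clique (proj₁ p) (proj₁ q)))
        where
        C∩W⊆A : C ∩ W ⊆ A
        C∩W⊆A = ∄∖⇒⊆ A? ∄x
      ... | yes (x , (cx , wx) , ¬ax) with both-in-A⊎one-outside a b | both-in-A⊎one-outside c d
      ...   | inj₁ (a∈A , b∈A) | inj₁ (c∈A , _) =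
                ⊥-elim (¬A-edge-nonnbr (S⊆W a∈S) (S⊆W b∈S) (S⊆W c∈S) a∈A b∈A c∈A ab ¬ac ¬bc a≢c b≢c)
      ...   | inj₁ (a∈A , b∈A) | inj₂ (w , w∈cd , w∉A) = inj₂ (fewNI a∈S b∈S (cd⇒S w∈cd) a∈A b∈A w∉A ab)
      ...   | inj₂ (w , w∈ab , w∉A) | inj₁ (c∈A , d∈A) = inj₂ (fewNI c∈S d∈S (ab⇒S w∈ab) c∈A d∈A w∉A cd)
      ...   | inj₂ (w , w∈ab , w∉A) | inj₂ (w′ , w′∈cd , w′∉A) =
                ⊥-elim (proj₁ (ab-cd-apart w∈ab w′∈cd)
                  (S∖A-clique cx wx ¬ax (ab⇒S w∈ab) (cd⇒S w′∈cd) w∉A w′∉A (proj₂ (ab-cd-apart w∈ab w′∈cd))))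

    module MinimalObstruction (¬polar : ¬ SInfPolar (suc (suc k)) G)
                              (polar-─ : ∀ x → SInfPolar (suc (suc k)) (G ─ x)) where

      C-big : ¬ count (C? ∩? U?) ≤ suc (suc k)
      C-big small = ¬polar (polarOn⇒polar (U-induced G) (polarOn-fewC U? small))

      NI-big : ¬ count (NI? U?) ≤ k
      NI-big small = ¬polar (polarOn⇒polar (U-induced G) (polarOn-fewNI U? small))

      fewC⊎fewNI-─ : ∀ {x} → ¬ S x → count (C? ∩? ∁? (x ≟_)) ≤ suc (suc k) ⊎ count (NI? (∁? (x ≟_))) ≤ k
      fewC⊎fewNI-─ {x} ¬sx = Necessary.fewC⊎fewNI (∁? (x ≟_)) (λ { sv refl → ¬sx sv })
                           (polar⇒polarOn (─-induced G x) (polar-─ x))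

      NI-─ : ∀ {x} → ¬ I x → NI U ∩ ∁ ｛ x ｝ ⊆ NI (∁ ｛ x ｝)
      NI-─ ¬ix ((cz , _ , y , iy , _ , yz) , x≢z) = cz , x≢z , y , iy , (λ { refl → ¬ix iy }) , yz

      fewC-─⇒C-small : ∀ {x} → C x → count (C? ∩? ∁? (x ≟_)) ≤ suc (suc k) →
                       count (C? ∩? U?) ≤ suc (suc (suc k))
      fewC-─⇒C-small cx small = ≤-trans (count-remove≤ (C? ∩? U?) (cx , tt))
        (s≤s (≤-trans (count-mono ((C? ∩? U?) ∩? ∁? (_ ≟_)) (C? ∩? ∁? (_ ≟_)) λ ((cv , _) , x≢v) → cv , x≢v)
                      small))

      C-small : count (C? ∩? U?) ≤ suc (suc (suc k))
      C-small with any? (λ x → C? x ×-dec ¬? (NI? U? x))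
      ... | yes (x , cx , x∉NI) with fewC⊎fewNI-─ (C⇒¬S cx)
      ...   | inj₁ small = fewC-─⇒C-small cx small
      ...   | inj₂ small = contradiction (≤-trans (count-mono (NI? U?) (NI? (∁? (x ≟_))) NI⊆) small) NI-big
        where
        NI⊆ : NI U ⊆ NI (∁ ｛ x ｝)
        NI⊆ p = NI-─ (C⇒¬I cx) (p , λ { refl → x∉NI p })
      C-small | no ∄ with any? C?
      ... | no ∄C = subst (_≤ _) (sym (∄⇒count≡0 (C? ∩? U?) λ (x , cx , _) → ∄C (x , cx))) z≤n
      ... | yes (x , cx) with fewC⊎fewNI-─ (C⇒¬S cx)
      ...   | inj₁ small = fewC-─⇒C-small cx small
      ...   | inj₂ small = begin
        count (C? ∩? U?)                       ≤⟨ count-mono (C? ∩? U?) (NI? U?) (C⊆NI ∘ proj₁) ⟩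
        count (NI? U?)                         ≤⟨ count-remove≤ (NI? U?) (C⊆NI cx) ⟩
        suc (count (NI? U? ∩? ∁? (x ≟_)))
          ≤⟨ s≤s (count-mono (NI? U? ∩? ∁? (x ≟_)) (NI? (∁? (x ≟_))) (NI-─ (C⇒¬I cx))) ⟩
        suc (count (NI? (∁? (x ≟_))))          ≤⟨ s≤s (≤-trans small (n≤1+n k)) ⟩
        suc (suc k)                            ≤⟨ n≤1+n _ ⟩
        suc (suc (suc k))                      ∎
        where
        open ≤-Reasoning
        C⊆NI : C ⊆ NI U
        C⊆NI = ∄∖⇒⊆ (NI? U?) ∄

      fewNI-─I : ∀ {y} → I y → count (NI? (∁? (y ≟_))) ≤ k
      fewNI-─I {y} iy with fewC⊎fewNI-─ (I⇒¬S iy)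
      ... | inj₂ small = small
      ... | inj₁ small = contradiction (≤-trans (count-mono (C? ∩? U?) (C? ∩? ∁? (y ≟_)) C⊆) small) C-big
        where
        C⊆ : C ∩ U ⊆ C ∩ ∁ ｛ y ｝
        C⊆ (cv , _) = cv , λ { refl → C⇒¬I cv iy }

      record PrivateNbr (y : Fin (n G)) : Set where
        field
          z      : Fin (n G)
          z∈C    : C z
          y~z    : Adj G y z
          unique : ∀ {y′} → I y′ → Adj G y′ z → y′ ≡ y

      private-nbr : ∀ {y} → I y → PrivateNbr y
      private-nbr {y} iy with any? (λ z → NI? U? z ×-dec ¬? (NI? (∁? (y ≟_)) z))
      ... | no ∄ = contradiction (≤-trans (count-mono (NI? U?) (NI? (∁? (y ≟_))) (∄∖⇒⊆ (NI? (∁? (y ≟_))) ∄))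
                                         (fewNI-─I iy)) NI-big
      ... | yes (z , (cz , _ , y₀ , iy₀ , _ , y₀z) , z∉NI) =
            record { z = z ; z∈C = cz ; y~z = subst (λ t → Adj G t z) (unique iy₀ y₀z) y₀z ; unique = unique }
        where
        unique : ∀ {y′} → I y′ → Adj G y′ z → y′ ≡ y
        unique {y′} iy′ y′z with y ≟ y′
        ... | yes y≡y′ = sym y≡y′
        ... | no y≢y′  = contradiction (cz , (λ { refl → C⇒¬I cz iy }) , y′ , iy′ , y≢y′ , y′z) z∉NI

      I-small : count I? ≤ suc k
      I-small with any? I?
      ... | no ∄ = subst (_≤ suc k) (sym (∄⇒count≡0 I? ∄)) z≤n
      ... | yes (y₀ , iy₀) = ≤-trans (count-remove≤ I? iy₀) (s≤s (≤-trans
            (↣⇒count≤count (I? ∩? ∁? (y₀ ≟_)) (NI? (∁? (y₀ ≟_))) by-private-nbr ∈NI)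
            (fewNI-─I iy₀)))
        where
        open PrivateNbr
        by-private-nbr : (I ∩ ∁ ｛ y₀ ｝) ↣ Fin (n G)
        by-private-nbr = record
          { to        = λ (iy , _) → z (private-nbr iy)
          ; injective = λ (iy , _) (iy′ , _) eq →
              unique (private-nbr iy′) iy (subst (Adj G _) eq (y~z (private-nbr iy)))
          }
        ∈NI : ∀ {y} (p : (I ∩ ∁ ｛ y₀ ｝) y) → NI (∁ ｛ y₀ ｝) (to by-private-nbr p)
        ∈NI {y} (iy , y₀≢y) = z∈C p , (λ { refl → C⇒¬I (z∈C p) iy₀ }) , y , iy , y₀≢y , y~z p
          where p = private-nbr iy

      S-small : count S? ≤ 4
      S-small = ≤-trans (count-mono S? abcd? S⊆abcd)
                  (≤-trans (count-｛｝∪ a _) (s≤s (≤-trans (count-｛｝∪ b _) (s≤s (≤-trans (count-｛｝∪ c _)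
                    (s≤s (count-｛｝ d)))))))
        where
        abcd? = (a ≟_) ∪? ((b ≟_) ∪? ((c ≟_) ∪? (d ≟_)))
        S⊆abcd : S ⊆ ｛ a ｝ ∪ (｛ b ｝ ∪ (｛ c ｝ ∪ ｛ d ｝))
        S⊆abcd sv = Sum.map sym (Sum.map sym (Sum.map sym sym)) (S-cover sv)

      size-bound : n G ≤ 2 * suc (suc k) + 4
      size-bound = begin
        n G                                   ≡⟨ sym count-U ⟩
        count (U? {A = Fin (n G)})            ≤⟨ count-mono U? (C? ∪? (S? ∪? I?)) (λ {v} _ → trichotomy v) ⟩
        count (C? ∪? (S? ∪? I?))              ≤⟨ count-∪ C? (S? ∪? I?) ⟩
        count C? + count (S? ∪? I?)
          ≤⟨ +-mono-≤ C-small′ (≤-trans (count-∪ S? I?) (+-mono-≤ S-small I-small)) ⟩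
        suc (suc (suc k)) + (4 + suc k)       ≡⟨ order-split k ⟩
        2 * suc (suc k) + 4                   ∎
        where
        open ≤-Reasoning
        C-small′ = ≤-trans (count-mono C? (C? ∩? U?) (_, tt)) C-small

splitPartition : (G : Graph) {p : Fin (n G) → Part} → Is2K2SplitPartition G p → SplitPartition G
splitPartition G {p} (clique , independent , _ , C-S , I-S) = record
  { block            = p
  ; C-clique         = λ {u} {v} → clique u v
  ; I-independent    = λ {u} {v} → independent u v
  ; C-S-complete     = λ {u} {v} → C-S u v
  ; I-S-anticomplete = λ {u} {v} → I-S u v
  }

twoK₂ : (G : Graph) {p : Fin (n G) → Part} (split : Is2K2SplitPartition G p) → Is2K2 G p →
        SplitGraph.TwoK₂ (splitPartition G split)
twoK₂ G _ (a , b , c , d , (_ , a≢c , a≢d , b≢c , b≢d , _) , (a∈S , b∈S , c∈S , d∈S) , cover ,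
            (ab , cd) , (¬ac , ¬ad , ¬bc , ¬bd)) = record
  { a = a ; b = b ; c = c ; d = d
  ; a∈S = a∈S ; b∈S = b∈S ; c∈S = c∈S ; d∈S = d∈S
  ; S-cover = λ {v} → cover v
  ; a≢c = a≢c ; a≢d = a≢d ; b≢c = b≢c ; b≢d = b≢d
  ; ab = ab ; cd = cd
  ; ¬ac = ¬ac ; ¬ad = ¬ad ; ¬bc = ¬bc ; ¬bd = ¬bd
  }

minimal-obstruction-order≤ : (k : ℕ) (G : Graph) → Is2K2Split G → MinimalSInfPolarObstruction (suc (suc k)) G →
                             n G ≤ 2 * suc (suc k) + 4
minimal-obstruction-order≤ k G (_ , split@(_ , _ , S-shape , _ , _)) (¬polar , polar-─) with S-shape
... | inj₁ noS  = contradiction (polarOn⇒polar (U-induced G) (polarOn-noS noS)) ¬polar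
  where open SplitGraph (splitPartition G split)
... | inj₂ 2K₂ = size-bound
  where
  open SplitGraph (splitPartition G split)
  open WithTwoK₂ (twoK₂ G split 2K₂)
  open MinimalObstruction ¬polar polar-─

is2K2Split : {G : Graph} (sp : SplitPartition G) → SplitGraph.TwoK₂ sp → Is2K2Split G
is2K2Split {G} sp M = block ,
  (λ _ _ → C-clique) , (λ _ _ → I-independent) ,
  inj₂ (a , b , c , d , (Adj⇒≢ G ab , a≢c , a≢d , b≢c , b≢d , Adj⇒≢ G cd) , (a∈S , b∈S , c∈S , d∈S) ,
        (λ _ → S-cover) , (ab , cd) , (¬ac , ¬ad , ¬bc , ¬bd)) ,
  (λ _ _ → C-S-complete) , (λ _ _ → I-S-anticomplete)
  where
  open SplitPartition sp
  open SplitGraph.TwoK₂ M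

-- The extremal graph

module Extremal (k : ℕ) where

  Vertex : Set
  Vertex = Fin (3 + k) ⊎ Fin 4 ⊎ Fin (1 + k)

  pattern inC i = inj₁ i
  pattern inS q = inj₂ (inj₁ q)
  pattern inI j = inj₂ (inj₂ j)

  role : Vertex → Part
  role (inC _) = cC
  role (inS _) = sS
  role (inI _) = iI

  attach : Fin (1 + k) → Fin (3 + k)
  attach j = suc (suc j)

  pair : Fin 4 → Fin 2
  pair zero          = zero
  pair (suc zero)    = zero
  pair (suc (suc _)) = suc zero

  adjV : Vertex → Vertex → Bool
  adjV (inC i) (inC j) = not (does (i ≟ j))
  adjV (inC _) (inS _) = true
  adjV (inC i) (inI j) = does (i ≟ attach j)
  adjV (inS _) (inC _) = true
  adjV (inS q) (inS r) = does (pair q ≟ pair r) ∧ not (does (q ≟ r))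
  adjV (inS _) (inI _) = false
  adjV (inI j) (inC i) = does (i ≟ attach j)
  adjV (inI _) (inS _) = false
  adjV (inI _) (inI _) = false

  adjV-sym : ∀ v w → adjV v w ≡ adjV w v
  adjV-sym (inC i) (inC j) = cong not (does-≟-sym i j)
  adjV-sym (inC _) (inS _) = refl
  adjV-sym (inC _) (inI _) = refl
  adjV-sym (inS _) (inC _) = refl
  adjV-sym (inS q) (inS r) = cong₂ _∧_ (does-≟-sym (pair q) (pair r)) (cong not (does-≟-sym q r))
  adjV-sym (inS _) (inI _) = refl
  adjV-sym (inI _) (inC _) = refl
  adjV-sym (inI _) (inS _) = refl
  adjV-sym (inI _) (inI _) = refl

  adjV-irrefl : ∀ v → adjV v v ≡ false
  adjV-irrefl (inC i) = cong not (dec-true (i ≟ i) refl)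
  adjV-irrefl (inS q) = trans (cong (λ b → does (pair q ≟ pair q) ∧ not b) (dec-true (q ≟ q) refl)) (∧-zeroʳ _)
  adjV-irrefl (inI _) = refl

  vertices : Fin (3 + k + (4 + (1 + k))) ↔ Vertex
  vertices = ↔-trans +↔⊎ (↔-refl ⊎-↔ +↔⊎)

  decode : Fin (3 + k + (4 + (1 + k))) → Vertex
  decode = Inverse.to vertices

  ⌜_⌝ : Vertex → Fin (3 + k + (4 + (1 + k)))
  ⌜_⌝ = Inverse.from vertices

  decode-⌜⌝ : ∀ v → decode ⌜ v ⌝ ≡ v
  decode-⌜⌝ = Inverse.strictlyInverseˡ vertices

  ⌜⌝-decode : ∀ u → ⌜ decode u ⌝ ≡ u
  ⌜⌝-decode = Inverse.strictlyInverseʳ vertices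

  decode-injective : ∀ {u v} → decode u ≡ decode v → u ≡ v
  decode-injective {u} {v} eq = trans (sym (⌜⌝-decode u)) (trans (cong ⌜_⌝ eq) (⌜⌝-decode v))

  ⌜⌝-injective : ∀ {v w} → ⌜ v ⌝ ≡ ⌜ w ⌝ → v ≡ w
  ⌜⌝-injective {v} {w} eq = trans (sym (decode-⌜⌝ v)) (trans (cong decode eq) (decode-⌜⌝ w))

  G : Graph
  G = record
    { n      = 3 + k + (4 + (1 + k))
    ; adj    = λ u v → adjV (decode u) (decode v)
    ; sym    = λ u v → adjV-sym (decode u) (decode v)
    ; irrefl = λ u → adjV-irrefl (decode u)
    }

  Adj-⌜⌝ : ∀ v w → adjV v w ≡ true → Adj G ⌜ v ⌝ ⌜ w ⌝
  Adj-⌜⌝ v w = subst₂ (λ x y → adjV x y ≡ true) (sym (decode-⌜⌝ v)) (sym (decode-⌜⌝ w))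

  Adj-⌜⌝⁻ : ∀ v w → Adj G ⌜ v ⌝ ⌜ w ⌝ → adjV v w ≡ true
  Adj-⌜⌝⁻ v w = subst₂ (λ x y → adjV x y ≡ true) (decode-⌜⌝ v) (decode-⌜⌝ w)

  role-⌜⌝ : ∀ v → role (decode ⌜ v ⌝) ≡ role v
  role-⌜⌝ v = cong role (decode-⌜⌝ v)

  C-index : ∀ {v} → role v ≡ cC → ∃ λ i → v ≡ inC i
  C-index {inC i} _ = i , refl
  C-index {inS _} ()
  C-index {inI _} ()

  S-index : ∀ {v} → role v ≡ sS → ∃ λ q → v ≡ inS q
  S-index {inC _} ()
  S-index {inS q} _ = q , refl
  S-index {inI _} ()

  I-index : ∀ {v} → role v ≡ iI → ∃ λ j → v ≡ inI j
  I-index {inC _} ()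
  I-index {inS _} ()
  I-index {inI j} _ = j , refl

  pendant-nbr : ∀ j v → adjV (inI j) v ≡ true → v ≡ inC (attach j)
  pendant-nbr j (inC i) e = cong inC (does≡true⇒ (i ≟ attach j) e)
  pendant-nbr j (inS _) ()
  pendant-nbr j (inI _) ()

  split : SplitPartition G
  split = record
    { block            = role ∘ decode
    ; C-clique         = λ {u} {v} cu cv u≢v → C-clique′ (decode u) (decode v) cu cv (u≢v ∘ decode-injective)
    ; I-independent    = λ {u} {v} → I-independent′ (decode u) (decode v)
    ; C-S-complete     = λ {u} {v} → C-S-complete′ (decode u) (decode v)
    ; I-S-anticomplete = λ {u} {v} → I-S-anticomplete′ (decode u) (decode v)
    }
    where
    C-clique′ : ∀ v w → role v ≡ cC → role w ≡ cC → v ≢ w → adjV v w ≡ true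
    C-clique′ (inC i) (inC j) _ _ v≢w = cong not (dec-false (i ≟ j) (v≢w ∘ cong inC))
    C-clique′ (inC _) (inS _) _ ()
    C-clique′ (inC _) (inI _) _ ()
    C-clique′ (inS _) _       ()
    C-clique′ (inI _) _       ()
    I-independent′ : ∀ v w → role v ≡ iI → role w ≡ iI → ¬ adjV v w ≡ true
    I-independent′ (inI _) (inI _) _ _ ()
    I-independent′ (inI _) (inC _) _ ()
    I-independent′ (inI _) (inS _) _ ()
    I-independent′ (inC _) _       ()
    I-independent′ (inS _) _       ()
    C-S-complete′ : ∀ v w → role v ≡ cC → role w ≡ sS → adjV v w ≡ true
    C-S-complete′ (inC _) (inS _) _ _ = refl
    C-S-complete′ (inC _) (inC _) _ ()
    C-S-complete′ (inC _) (inI _) _ ()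
    C-S-complete′ (inS _) _       ()
    C-S-complete′ (inI _) _       ()
    I-S-anticomplete′ : ∀ v w → role v ≡ iI → role w ≡ sS → ¬ adjV v w ≡ true
    I-S-anticomplete′ (inI _) (inS _) _ _ ()
    I-S-anticomplete′ (inI _) (inC _) _ ()
    I-S-anticomplete′ (inI _) (inI _) _ ()
    I-S-anticomplete′ (inC _) _       ()
    I-S-anticomplete′ (inS _) _       ()

  open SplitGraph split

  matching : TwoK₂
  matching = record
    { a = ⌜ inS q₀ ⌝ ; b = ⌜ inS q₁ ⌝ ; c = ⌜ inS q₂ ⌝ ; d = ⌜ inS q₃ ⌝
    ; a∈S = role-⌜⌝ (inS q₀) ; b∈S = role-⌜⌝ (inS q₁)
    ; c∈S = role-⌜⌝ (inS q₂) ; d∈S = role-⌜⌝ (inS q₃)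
    ; S-cover = λ {u} su → by-index (S-index su) (⌜⌝-decode u)
    ; a≢c = (λ ()) ∘ ⌜⌝-injective {inS q₀} {inS q₂} ; a≢d = (λ ()) ∘ ⌜⌝-injective {inS q₀} {inS q₃}
    ; b≢c = (λ ()) ∘ ⌜⌝-injective {inS q₁} {inS q₂} ; b≢d = (λ ()) ∘ ⌜⌝-injective {inS q₁} {inS q₃}
    ; ab = Adj-⌜⌝ (inS q₀) (inS q₁) refl ; cd = Adj-⌜⌝ (inS q₂) (inS q₃) refl
    ; ¬ac = (λ ()) ∘ Adj-⌜⌝⁻ (inS q₀) (inS q₂) ; ¬ad = (λ ()) ∘ Adj-⌜⌝⁻ (inS q₀) (inS q₃)
    ; ¬bc = (λ ()) ∘ Adj-⌜⌝⁻ (inS q₁) (inS q₂) ; ¬bd = (λ ()) ∘ Adj-⌜⌝⁻ (inS q₁) (inS q₃)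
    }
    where
    q₀ q₁ q₂ q₃ : Fin 4
    q₀ = zero
    q₁ = suc zero
    q₂ = suc (suc zero)
    q₃ = suc (suc (suc zero))
    by-index : ∀ {u} → (∃ λ q → decode u ≡ inS q) → ⌜ decode u ⌝ ≡ u →
               u ≡ ⌜ inS q₀ ⌝ ⊎ u ≡ ⌜ inS q₁ ⌝ ⊎ u ≡ ⌜ inS q₂ ⌝ ⊎ u ≡ ⌜ inS q₃ ⌝
    by-index (zero                , eq) u≡ = inj₁ (trans (sym u≡) (cong ⌜_⌝ eq))
    by-index (suc zero            , eq) u≡ = inj₂ (inj₁ (trans (sym u≡) (cong ⌜_⌝ eq)))
    by-index (suc (suc zero)      , eq) u≡ = inj₂ (inj₂ (inj₁ (trans (sym u≡) (cong ⌜_⌝ eq))))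
    by-index (suc (suc (suc zero)), eq) u≡ = inj₂ (inj₂ (inj₂ (trans (sym u≡) (cong ⌜_⌝ eq))))

  open WithTwoK₂ matching

  attach∈NI : ∀ j → NI U ⌜ inC (attach j) ⌝
  attach∈NI j = role-⌜⌝ (inC (attach j)) , tt , ⌜ inI j ⌝ , role-⌜⌝ (inI j) , tt ,
                Adj-⌜⌝ (inI j) (inC (attach j)) (dec-true (attach j ≟ attach j) refl)

  pendant : ∀ {W z} → NI W z → Fin (1 + k)
  pendant (_ , _ , _ , iy , _) = proj₁ (I-index iy)

  decode-pendant : ∀ {W z} (p : NI W z) → let (_ , _ , y , _) = p in decode y ≡ inI (pendant p)
  decode-pendant (_ , _ , _ , iy , _) = proj₂ (I-index iy)

  decode-NI : ∀ {W z} (p : NI W z) → decode z ≡ inC (attach (pendant p))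
  decode-NI {z = z} p@(_ , _ , _ , _ , _ , yz) =
    pendant-nbr (pendant p) (decode z) (subst (λ v → adjV v (decode z) ≡ true) (decode-pendant p) yz)

  C-lower : 3 + k ≤ count (C? ∩? U?)
  C-lower = injective⇒≤count (C? ∩? U?) (λ i → ⌜ inC i ⌝)
              (λ {i} {j} → inj₁-injective ∘ ⌜⌝-injective {inC i} {inC j}) λ i → role-⌜⌝ (inC i) , tt

  C-upper : count (C? ∩? U?) ≤ 3 + k
  C-upper = ↣Fin⇒count≤ (C? ∩? U?) record
    { to        = λ (cu , _) → proj₁ (C-index cu)
    ; injective = λ {u} {v} (cu , _) (cv , _) eq →
        decode-injective {u} {v} (trans (proj₂ (C-index cu)) (trans (cong inC eq) (sym (proj₂ (C-index cv)))))
    }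

  NI-lower : 1 + k ≤ count (NI? U?)
  NI-lower = injective⇒≤count (NI? U?) (λ j → ⌜ inC (attach j) ⌝)
               (λ {i} {j} → suc-injective ∘ suc-injective ∘ inj₁-injective ∘
                            ⌜⌝-injective {inC (attach i)} {inC (attach j)})
               attach∈NI

  NI-upper : count (NI? U?) ≤ 1 + k
  NI-upper = ↣Fin⇒count≤ (NI? U?) record
    { to        = λ {z} → pendant {U} {z}
    ; injective = λ {u} {v} p q eq → decode-injective {u} {v}
        (trans (decode-NI {U} {u} p) (trans (cong (λ j → inC (attach j)) eq) (sym (decode-NI {U} {v} q))))
    }

  ¬polar : ¬ SInfPolar (suc (suc k)) G
  ¬polar P with Necessary.fewC⊎fewNI U? (λ _ → tt) (polar⇒polarOn (U-induced G) P)
  ... | inj₁ small = 1+n≰n (≤-trans C-lower small)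
  ... | inj₂ small = 1+n≰n (≤-trans NI-lower small)

  fewC-─C : ∀ {x} → C x → count (C? ∩? ∁? (x ≟_)) ≤ 2 + k
  fewC-─C {x} cx = ≤-pred (≤-trans
    (s≤s (count-mono (C? ∩? ∁? (x ≟_)) ((C? ∩? U?) ∩? ∁? (x ≟_)) λ (cv , x≢v) → (cv , tt) , x≢v))
    (≤-trans (≤-reflexive (count-remove (C? ∩? U?) {x} (cx , tt))) C-upper))

  NI-─pendant : ∀ {x j} → decode x ≡ inI j → NI (∁ ｛ x ｝) ⊆ NI U ∩ ∁ ｛ ⌜ inC (attach j) ⌝ ｝
  NI-─pendant {x} {j} dx {z} p@(cz , _ , y , iy , x≢y , yz) = NI⊆NI-U p , attach-j≢z
    where
    attach-j≢z : ⌜ inC (attach j) ⌝ ≢ z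
    attach-j≢z eq = x≢y (decode-injective (trans dx (trans (cong inI j≡) (sym (decode-pendant p)))))
      where
      j≡ : j ≡ pendant p
      j≡ = suc-injective (suc-injective (inj₁-injective
             (trans (sym (decode-⌜⌝ (inC (attach j)))) (trans (cong decode eq) (decode-NI p)))))

  fewNI-─I : ∀ {x j} → decode x ≡ inI j → count (NI? (∁? (x ≟_))) ≤ k
  fewNI-─I {x} {j} dx = ≤-pred (≤-trans
    (s≤s (count-mono (NI? (∁? (x ≟_))) (NI? U? ∩? ∁? (⌜ inC (attach j) ⌝ ≟_)) (NI-─pendant dx)))
    (≤-trans (≤-reflexive (count-remove (NI? U?) (attach∈NI j))) NI-upper))

  polarOn-─ : ∀ x → PolarOn (suc (suc k)) G (∁ ｛ x ｝)
  polarOn-─ x with decode x in dx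
  ... | inC _ = polarOn-fewC (∁? (x ≟_)) (fewC-─C {x} (cong role dx))
  ... | inS _ = polarOn-─S {x = x} (cong role dx) (≤-trans (count-mono (NI? (∁? (x ≟_))) (NI? U?) NI⊆NI-U) NI-upper)
  ... | inI _ = polarOn-fewNI (∁? (x ≟_)) (fewNI-─I {x} dx)

  minimal : MinimalSInfPolarObstruction (suc (suc k)) G
  minimal = ¬polar , λ x → polarOn⇒polar (─-induced G x) (polarOn-─ x)

  is-2K₂-split : Is2K2Split G
  is-2K₂-split = is2K2Split split matching

  order : n G ≡ 2 * suc (suc k) + 4
  order = order-split k

-- Finitely many graphs up to isomorphism

vectors : {A : Set} (m : ℕ) → List A → List (Vec A m)
vectors zero    xs = [] ∷ []
vectors (suc m) xs = cartesianProductWith _∷_ xs (vectors m xs)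

∈-vectors : {A : Set} {xs : List A} → (∀ x → x ∈ xs) → (v : Vec A m) → v ∈ vectors m xs
∈-vectors every []       = here refl
∈-vectors every (x ∷ v) = ∈-cartesianProductWith⁺ _∷_ (every x) (∈-vectors every v)

∈-booleans : ∀ b → b ∈ true ∷ false ∷ []
∈-booleans true  = here refl
∈-booleans false = there (here refl)

-- Symmetrised and loop-free, so that every table defines a graph.
tableGraph : (m : ℕ) → Vec (Vec Bool m) m → Graph
tableGraph m t = record
  { n      = m
  ; adj    = λ u v → (entry u v ∧ entry v u) ∧ not (does (u ≟ v))
  ; sym    = λ u v → cong₂ (λ x y → x ∧ not y) (∧-comm (entry u v) (entry v u)) (does-≟-sym u v)
  ; irrefl = λ u → trans (cong (λ y → (entry u u ∧ entry u u) ∧ not y) (dec-true (u ≟ u) refl)) (∧-zeroʳ _)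
  }
  where
  entry : Fin m → Fin m → Bool
  entry u v = lookup (lookup t u) v

tableGraphs : (m : ℕ) → List Graph
tableGraphs m = map (tableGraph m) (vectors m (vectors m (true ∷ false ∷ [])))

graphsUpTo : ℕ → List Graph
graphsUpTo N = concatMap tableGraphs (upTo (suc N))

adjacencyTable : (G : Graph) → Vec (Vec Bool (n G)) (n G)
adjacencyTable G = tabulate λ u → tabulate (adj G u)

≅-tableGraph : (G : Graph) → G ≅ tableGraph (n G) (adjacencyTable G)
≅-tableGraph G = ⤖-id (Fin (n G)) , same-adj
  where
  entry≡adj : ∀ u v → lookup (lookup (adjacencyTable G) u) v ≡ adj G u v
  entry≡adj u v = trans (cong (λ r → lookup r v) (lookup∘tabulate (λ u → tabulate (adj G u)) u))
                        (lookup∘tabulate (adj G u) v)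
  same-adj : ∀ u v → adj (tableGraph (n G) (adjacencyTable G)) u v ≡ adj G u v
  same-adj u v rewrite entry≡adj u v | entry≡adj v u with u ≟ v
  ... | yes refl rewrite irrefl G u = refl
  ... | no _     rewrite Graph.sym G v u = trans (∧-identityʳ _) (∧-idem _)

tableGraph∈graphsUpTo : (G : Graph) {N : ℕ} → n G ≤ N → tableGraph (n G) (adjacencyTable G) ∈ graphsUpTo N
tableGraph∈graphsUpTo G n≤N = ∈-concatMap⁺ tableGraphs (lose (∈-upTo⁺ (s≤s n≤N))
  (∈-map⁺ (tableGraph (n G)) (∈-vectors (∈-vectors ∈-booleans) (adjacencyTable G))))

mainTheorem16 : (s : ℕ) → 2 ≤ s →
    ((G : Graph) → Is2K2Split G → MinimalSInfPolarObstruction s G →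
      n G ≤ 2 * s + 4)
    × (Σ Graph λ G → Is2K2Split G × MinimalSInfPolarObstruction s G ×
      n G ≡ 2 * s + 4)
    × (Σ (List Graph) λ L → (G : Graph) → Is2K2Split G →
      MinimalSInfPolarObstruction s G → Σ Graph λ H → H ∈ L × G ≅ H)
mainTheorem16 (suc (suc k)) (s≤s (s≤s z≤n)) =
  minimal-obstruction-order≤ k ,
  (Extremal.G k , Extremal.is-2K₂-split k , Extremal.minimal k , Extremal.order k) ,
  (graphsUpTo (2 * suc (suc k) + 4) , λ H split minimal →
    tableGraph (n H) (adjacencyTable H) ,
    tableGraph∈graphsUpTo H (minimal-obstruction-order≤ k H split minimal) ,
    ≅-tableGraph H)
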